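{- Let $(A_n(x))_{n\ge1}$, $(B_n(x))_{n\ge1}$, $(C_n(x))_{n\ge1}$ be sequences of formal power series (or polynomials) in $x$. (i) Suppose $B_1(x)=1$ and $A_n(x)=\sum_{d\mid n}B_d(x)\,C_{n/d}(x^d)$ for all $n\ge1$. Then for all $n\ge1$, $$C_n(x)=\sum_{\substack{k\ge0,\ 1=d_0\mid d_1\mid\dots\mid d_k\mid n\\ d_i\ne d_{i+1}\ (0\le i\le k-1)}}(-1)^k\,A_{n/d_k}(x^{d_k})\prod_{i=0}^{k-1}B_{d_{i+1}/d_i}(x^{d_i}).$$ (ii) Suppose $A_n(x)=B_n(x)+\sum_{d\mid n,\ d\ne n}A_d(x)\,C_{n/d}(x^d)$ for all $n\ge1$. Then for all $n\ge1$, $$A_n(x)=\sum_{\substack{k\ge0,\ d_1\mid d_2\mid\dots\mid d_{k+1}=n\\ d_i\ne d_{i+1}\ (1\le i\le k)}}B_{d_1}(x)\prod_{i=1}^{k}C_{d_{i+1}/d_i}(x^{d_i}).$$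
   Context: All indices $d, d_i$ are positive integers and $\mid$ denotes divisibility. -}

module Defs where

open import Level using (Level)
open import Data.Nat as ℕ using (ℕ; zero; suc; _∸_)
open import Data.Nat.DivMod using (_/_)
open import Data.Nat.Divisibility using (_∣_; _∣?_)
open import Data.List using (List; []; _∷_; map; filter; upTo; foldr; _++_; length)
open import Data.Bool using (Bool; true; false; _∧_; not)
open import Relation.Nullary.Decidable using (⌊_⌋; does)
open import Algebra.Bundles using (CommutativeRing)
open import Relation.Nullary using (yes; no; ¬?)
open import Data.Bool.Properties using (T?)

-- Natural-number division, total: m div 0 = 0 (never used: all indices are ≥ 1).
_div_ : ℕ → ℕ → ℕ
m div zero = 0
m div suc k = m / suc k

divisors : ℕ → List ℕ
divisors n = filter (λ d → d ∣? n) (Data.List.map suc (upTo n))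

properDivisors : ℕ → List ℕ
properDivisors n = filter (λ d → ¬? (d ℕ.≟ n)) (divisors n)

sublists : {a : Level} {A : Set a} → List A → List (List A)
sublists [] = [] ∷ []
sublists (x ∷ xs) = let r = sublists xs in map (x ∷_) r ++ r

divB : ℕ → ℕ → Bool
divB d e = ⌊ d ∣? e ⌋

eqB : ℕ → ℕ → Bool
eqB d e = ⌊ d ℕ.≟ e ⌋

strictDivChain : List ℕ → Bool
strictDivChain [] = true
strictDivChain (d ∷ []) = true
strictDivChain (d ∷ e ∷ rest) = divB d e ∧ not (eqB d e) ∧ strictDivChain (e ∷ rest)

headIs : ℕ → List ℕ → Bool
headIs a [] = false
headIs a (d ∷ _) = eqB d a

lastIs : ℕ → List ℕ → Bool
lastIs a [] = false
lastIs a (d ∷ []) = eqB d a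
lastIs a (_ ∷ e ∷ rest) = lastIs a (e ∷ rest)

-- Chains 1 = d_0 ∣ d_1 ∣ ... ∣ d_k ∣ n with d_i ≠ d_{i+1}, as lists [d_0,...,d_k].
-- Every d_i divides n, and such a chain is strictly increasing, so it is
-- exactly a sublist of the (increasing) divisor list of n.
chainsI : ℕ → List (List ℕ)
chainsI n = filter (λ c → T? (headIs 1 c ∧ strictDivChain c))
                   (sublists (divisors n))

chainsII : ℕ → List (List ℕ)
chainsII n = filter (λ c → T? (lastIs n c ∧ strictDivChain c))
                    (sublists (divisors n))

module PowerSeries {c ℓ : Level} (R : CommutativeRing c ℓ) where
  open CommutativeRing R

  Series : Set c
  Series = ℕ → Carrier

  _≋_ : Series → Series → Set ℓ
  f ≋ g = ∀ m → f m ≈ g m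

  𝟙 : Series
  𝟙 zero = 1#
  𝟙 (suc _) = 0#

  _⊕_ : Series → Series → Series
  (f ⊕ g) m = f m + g m

  ⊖_ : Series → Series
  (⊖ f) m = - f m

  _⊛_ : Series → Series → Series
  (f ⊛ g) m = foldr _+_ 0# (map (λ i → f i * g (m ∸ i)) (upTo (suc m)))

  ΣS : List Series → Series
  ΣS = foldr _⊕_ (λ _ → 0#)

  -- substitution x ↦ x^d (for d ≥ 1): coefficient m is f_{m/d} if d ∣ m, else 0
  sub : ℕ → Series → Series
  sub d f m with d ∣? m
  ... | yes _ = f (m div d)
  ... | no _ = 0#

  signed : ℕ → Series → Series
  signed zero f = f
  signed (suc k) f = ⊖ (signed k f)

  sumDiv : ℕ → (ℕ → Series) → Series
  sumDiv n F = ΣS (map F (divisors n))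

  chainProd : (ℕ → Series) → List ℕ → Series
  chainProd S [] = 𝟙
  chainProd S (d ∷ []) = 𝟙
  chainProd S (d ∷ e ∷ rest) = sub d (S (e div d)) ⊛ chainProd S (e ∷ rest)

  lastOr1 : List ℕ → ℕ
  lastOr1 [] = 1
  lastOr1 (d ∷ []) = d
  lastOr1 (_ ∷ e ∷ rest) = lastOr1 (e ∷ rest)

  headOr1 : List ℕ → ℕ
  headOr1 [] = 1
  headOr1 (d ∷ _) = d

  termI : (A B : ℕ → Series) → ℕ → List ℕ → Series
  termI A B n ch = signed (length ch ∸ 1)
                     (sub (lastOr1 ch) (A (n div lastOr1 ch)) ⊛ chainProd B ch)

  termII : (B C : ℕ → Series) → List ℕ → Series
  termII B C ch = B (headOr1 ch) ⊛ chainProd C ch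

-- Each chain sum satisfies the same recursion over the divisors of n as the series it is
-- claimed to equal, and such a recursion has a unique solution by strong induction on n.
-- (ii) A chain ending in n is either [n] or a chain ending in a proper divisor d of n followed
-- by n, and then its term is the term of the shorter chain times C_{n/d}(x^d); so the chain
-- sum satisfies the defining recursion of A.
-- (i) A chain 1 = d₀ ∣ d₁ ∣ ⋯ of divisors of n is either [1] or 1 followed by d₁ times a chain
-- of divisors of n/d₁ starting at 1, and then its term is −B_{d₁}(x) times the term of that
-- chain at x^{d₁}. So the chain sum T satisfies T_n = A_n − Σ_{d∣n, d≠1} B_d(x) T_{n/d}(x^d),
-- and so does C: split the summand d = 1, which is B₁(x) C_n(x) = C_n(x), off the hypothesis.
-- Sums over chains are regrouped along these decompositions by exhibiting permutations: both
-- lists are duplicate-free and have the same members.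

module Submission where

open import Defs
open import Level using (Level)
open import Data.Nat using (ℕ; _≤_)
open import Data.List using (map)
open import Data.Product using (_×_; _,_)
open import Algebra.Bundles using (CommutativeRing)

module DivisorChains where

  open import Data.Bool using (T; _∧_)
  open import Data.Bool.Properties using (T-∧; T?)
  open import Data.Empty using (⊥-elim)
  open import Data.List using (List; []; _∷_; [_]; _∷ʳ_; map; filter; upTo; applyUpTo; concatMap; initLast; _∷ʳ′_)
  open import Data.List.Membership.Propositional using (_∈_; find; lose)
  open import Data.List.Membership.Propositional.Properties
    using ( ∈-map⁺; ∈-map⁻; ∈-++⁺ˡ; ∈-++⁺ʳ; ∈-++⁻; ∈-filter⁺; ∈-filter⁻
          ; ∈-concatMap⁺; ∈-concatMap⁻; ∈-applyUpTo⁻; ∈-upTo⁺)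
  open import Data.List.Membership.Propositional.Properties.WithK using (unique∧set⇒bag)
  open import Data.List.Properties
    using (∷-injective; ∷-injectiveˡ; ∷-injectiveʳ; map-injective; filter-accept; filter-reject; filter-all)
  open import Data.List.Relation.Binary.BagAndSetEquality using (∼bag⇒↭)
  open import Data.List.Relation.Binary.Permutation.Propositional using (_↭_)
  open import Data.List.Relation.Binary.Subset.Propositional using (_⊆_)
  open import Data.List.Relation.Unary.All as All using (All; []; _∷_)
  open import Data.List.Relation.Unary.All.Properties using (∷ʳ⁺; ∷ʳ⁻) renaming (map⁺ to All-map⁺; map⁻ to All-map⁻)
  open import Data.List.Relation.Unary.AllPairs as AllPairs using (AllPairs; []; _∷_)
  import Data.List.Relation.Unary.AllPairs.Properties as AllPairs
  open import Data.List.Relation.Unary.Any using (here; there)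
  open import Data.List.Relation.Unary.Linked as Linked using (Linked; []; [-]; _∷_)
  open import Data.List.Relation.Unary.Linked.Properties
    using (Linked⇒AllPairs) renaming (map⁺ to Linked-map⁺; map⁻ to Linked-map⁻)
  open import Data.List.Relation.Unary.Unique.Propositional using (Unique)
  import Data.List.Relation.Unary.Unique.Propositional.Properties as Unique
  open import Data.Nat using (ℕ; zero; suc; _*_; _≤_; _<_; _≟_; z≤n; s≤s)
  open import Data.Nat.Divisibility
    using (_∣_; _∣?_; ∣-refl; ∣-trans; ∣-antisym; ∣⇒≤; 0∣⇒≡0; 1∣_; *-monoʳ-∣; *-cancelˡ-∣)
  open import Data.Nat.DivMod using (m*[n/m]≡n; m/n<m)
  open import Data.Nat.Properties using (≤∧≢⇒<; <⇒≢; <-trans; <-irrefl; *-cancelˡ-≡; *-identityʳ; *-zeroʳ; n≢0⇒n>0)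
  open import Data.Product using (∃-syntax; _×_; _,_; proj₁; proj₂)
  open import Data.Sum using (inj₁; inj₂)
  open import Function.Bundles using (Equivalence; mk⇔)
  open import Relation.Binary.Core using (Rel)
  open import Relation.Binary.Definitions using (Transitive; Irreflexive)
  open import Relation.Binary.PropositionalEquality using (_≡_; _≢_; refl; sym; trans; cong; cong₂; subst; module ≡-Reasoning)
  open import Relation.Nullary using (¬_; ¬?)
  open import Relation.Nullary.Decidable using (toWitness; fromWitness; toWitnessFalse; fromWitnessFalse)
  open import Data.Nat.Induction using (<-rec)
  open import Relation.Binary.Bundles using (Setoid)

  unique∧set⇒↭ : ∀ {a} {A : Set a} {xs ys : List A} →
    Unique xs → Unique ys → xs ⊆ ys → ys ⊆ xs → xs ↭ ys
  unique∧set⇒↭ xs! ys! xs⊆ys ys⊆xs = ∼bag⇒↭ (unique∧set⇒bag xs! ys! (mk⇔ xs⊆ys ys⊆xs))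

  ∈-concatMap⇒∃ : ∀ {a b} {A : Set a} {B : Set b} (f : A → List B) {xs : List A} {v} →
    v ∈ concatMap f xs → ∃[ x ] x ∈ xs × v ∈ f x
  ∈-concatMap⇒∃ f p = find (∈-concatMap⁻ f p)

  ∃⇒∈-concatMap : ∀ {a b} {A : Set a} {B : Set b} (f : A → List B) {xs : List A} {x v} →
    x ∈ xs → v ∈ f x → v ∈ concatMap f xs
  ∃⇒∈-concatMap f x∈ v∈ = ∈-concatMap⁺ f (lose x∈ v∈)

  concatMap-unique : ∀ {a b} {A : Set a} {B : Set b} (f : A → List B) {xs : List A} →
    Unique xs → (∀ {x} → x ∈ xs → Unique (f x)) →
    (∀ {x y v} → v ∈ f x → v ∈ f y → x ≡ y) → Unique (concatMap f xs)
  concatMap-unique f xs! f! f-disjoint =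
    Unique.concat⁺ (All-map⁺ (All.tabulate f!)) (AllPairs.map⁺ (AllPairs.map (λ x≢y {v} (p , q) → x≢y (f-disjoint p q)) xs!))

  ∷ʳ-injective : ∀ {a} {A : Set a} (xs ys : List A) {x y} → xs ∷ʳ x ≡ ys ∷ʳ y → xs ≡ ys × x ≡ y
  ∷ʳ-injective [] [] refl = refl , refl
  ∷ʳ-injective [] (_ ∷ []) ()
  ∷ʳ-injective [] (_ ∷ _ ∷ _) ()
  ∷ʳ-injective (_ ∷ []) [] ()
  ∷ʳ-injective (_ ∷ _ ∷ _) [] ()
  ∷ʳ-injective (x ∷ xs) (y ∷ ys) eq with ∷-injective eq
  ... | refl , eq′ with ∷ʳ-injective xs ys eq′
  ... | refl , refl = refl , refl

  []≢∷ʳ : ∀ {a} {A : Set a} (xs : List A) {x} → [] ≢ xs ∷ʳ x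
  []≢∷ʳ [] ()
  []≢∷ʳ (_ ∷ _) ()

  module _ {a ℓ} {A : Set a} {R : Rel A ℓ} where

    AllPairs-∷ʳ⇒All : ∀ c {x} → AllPairs R (c ∷ʳ x) → All (λ y → R y x) c
    AllPairs-∷ʳ⇒All [] _ = []
    AllPairs-∷ʳ⇒All (y ∷ c) (Ry ∷ Rc) = proj₂ (∷ʳ⁻ Ry) ∷ AllPairs-∷ʳ⇒All c Rc

    Linked-∷ʳ⁺ : ∀ c {x y} → Linked R (c ∷ʳ x) → R x y → Linked R (c ∷ʳ x ∷ʳ y)
    Linked-∷ʳ⁺ [] _ Rxy = Rxy ∷ [-]
    Linked-∷ʳ⁺ (_ ∷ []) (Rzx ∷ [-]) Rxy = Rzx ∷ Rxy ∷ [-]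
    Linked-∷ʳ⁺ (_ ∷ z ∷ c) (R₁ ∷ l) Rxy = R₁ ∷ Linked-∷ʳ⁺ (z ∷ c) l Rxy

    Linked-∷ʳ⁻ : ∀ c {x y} → Linked R (c ∷ʳ x ∷ʳ y) → Linked R (c ∷ʳ x) × R x y
    Linked-∷ʳ⁻ [] (Rxy ∷ [-]) = [-] , Rxy
    Linked-∷ʳ⁻ (_ ∷ []) (Rzx ∷ Rxy ∷ [-]) = Rzx ∷ [-] , Rxy
    Linked-∷ʳ⁻ (_ ∷ z ∷ c) (R₁ ∷ l) with Linked-∷ʳ⁻ (z ∷ c) l
    ... | l′ , Rxy = R₁ ∷ l′ , Rxy

  module _ {a} {A : Set a} where

    sublists-⊆ : ∀ (xs : List A) {ys} → ys ∈ sublists xs → ys ⊆ xs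
    sublists-⊆ [] (here refl) ()
    sublists-⊆ (x ∷ xs) p v∈ys with ∈-++⁻ (map (x ∷_) (sublists xs)) p
    ... | inj₂ q = there (sublists-⊆ xs q v∈ys)
    ... | inj₁ q with ∈-map⁻ (x ∷_) q | v∈ys
    ...   | _ , _ , refl | here refl = here refl
    ...   | _ , q′ , refl | there v∈ = there (sublists-⊆ xs q′ v∈)

    []∈sublists : ∀ (xs : List A) → [] ∈ sublists xs
    []∈sublists [] = here refl
    []∈sublists (x ∷ xs) = ∈-++⁺ʳ (map (x ∷_) (sublists xs)) ([]∈sublists xs)

    sublists-unique : ∀ {xs : List A} → Unique xs → Unique (sublists xs)
    sublists-unique {[]} [] = [] ∷ []
    sublists-unique {x ∷ xs} (x∉xs ∷ xs!) =
      Unique.++⁺ (Unique.map⁺ ∷-injectiveʳ (sublists-unique xs!)) (sublists-unique xs!) x∷-disjoint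
      where
      x∷-disjoint : ∀ {v} → ¬ (v ∈ map (x ∷_) (sublists xs) × v ∈ sublists xs)
      x∷-disjoint (p , q) with ∈-map⁻ (x ∷_) p
      ... | _ , _ , refl = All.lookup x∉xs (sublists-⊆ xs q (here refl)) refl

    module _ {ℓ} {_≺_ : Rel A ℓ} (≺-irrefl : Irreflexive _≡_ _≺_) (≺-trans : Transitive _≺_) where

      sorted-⊆⇒∈sublists : ∀ {xs ys} → AllPairs _≺_ xs → AllPairs _≺_ ys → ys ⊆ xs → ys ∈ sublists xs
      sorted-⊆⇒∈sublists {[]} {[]} _ _ _ = here refl
      sorted-⊆⇒∈sublists {[]} {y ∷ ys} _ _ ys⊆ with ys⊆ (here refl)
      ... | ()
      sorted-⊆⇒∈sublists {x ∷ xs} {[]} _ _ _ = []∈sublists (x ∷ xs)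
      sorted-⊆⇒∈sublists {x ∷ xs} {y ∷ ys} (x≺xs ∷ xs↑) (y≺ys ∷ ys↑) ys⊆ with ys⊆ (here refl)
      ... | here refl = ∈-++⁺ˡ (∈-map⁺ (x ∷_) (sorted-⊆⇒∈sublists xs↑ ys↑ tail⊆))
        where
        tail⊆ : ys ⊆ xs
        tail⊆ v∈ys = away (ys⊆ (there v∈ys)) (All.lookup y≺ys v∈ys)
          where
          away : ∀ {v} → v ∈ x ∷ xs → x ≺ v → v ∈ xs
          away (here refl) x≺x = ⊥-elim (≺-irrefl refl x≺x)
          away (there v∈) _ = v∈
      ... | there y∈xs = ∈-++⁺ʳ (map (x ∷_) (sublists xs)) (sorted-⊆⇒∈sublists xs↑ (y≺ys ∷ ys↑) all⊆)
        where
        all⊆ : y ∷ ys ⊆ xs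
        all⊆ (here refl) = y∈xs
        all⊆ (there v∈ys) with ys⊆ (there v∈ys)
        ... | here refl = ⊥-elim (≺-irrefl refl (≺-trans (All.lookup x≺xs y∈xs) (All.lookup y≺ys v∈ys)))
        ... | there v∈xs = v∈xs

  module _ {a ℓ} (S : Setoid a ℓ) where
    open Setoid S using (Carrier; _≈_) renaming (trans to ≈-trans; sym to ≈-sym)

    recursion-unique : (Φ : ℕ → (ℕ → Carrier) → Carrier) →
      (∀ n {F G} → 1 ≤ n → (∀ m → 1 ≤ m → m < n → F m ≈ G m) → Φ n F ≈ Φ n G) →
      ∀ {F G} → (∀ n → 1 ≤ n → F n ≈ Φ n F) → (∀ n → 1 ≤ n → G n ≈ Φ n G) →
      ∀ n → 1 ≤ n → F n ≈ G n
    recursion-unique Φ Φ-local {F} {G} F-rec G-rec = <-rec _ step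
      where
      step : ∀ n → (∀ {m} → m < n → 1 ≤ m → F m ≈ G m) → 1 ≤ n → F n ≈ G n
      step n ih 1≤n =
        ≈-trans (F-rec n 1≤n) (≈-trans (Φ-local n 1≤n (λ m 1≤m m<n → ih m<n 1≤m)) (≈-sym (G-rec n 1≤n)))

  infix 4 _⊏_
  _⊏_ : Rel ℕ _
  d ⊏ e = d ∣ e × d ≢ e

  ⊏-trans : Transitive _⊏_
  ⊏-trans (d∣e , d≢e) (e∣f , _) = ∣-trans d∣e e∣f , λ { refl → d≢e (∣-antisym d∣e e∣f) }

  ∣⇒pos : ∀ {d n} → 1 ≤ n → d ∣ n → 1 ≤ d
  ∣⇒pos {zero} {suc _} _ 0∣n with 0∣⇒≡0 0∣n
  ... | ()
  ∣⇒pos {suc _} _ _ = s≤s z≤n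

  ⊏⇒< : ∀ {d e} → 1 ≤ e → d ⊏ e → d < e
  ⊏⇒< {e = suc _} _ (d∣e , d≢e) = ≤∧≢⇒< (∣⇒≤ d∣e) d≢e

  *-monoʳ-⊏ : ∀ k {d e} → d ⊏ e → suc k * d ⊏ suc k * e
  *-monoʳ-⊏ k (d∣e , d≢e) = *-monoʳ-∣ (suc k) d∣e , λ eq → d≢e (*-cancelˡ-≡ _ _ (suc k) eq)

  *-cancelˡ-⊏ : ∀ k {d e} → suc k * d ⊏ suc k * e → d ⊏ e
  *-cancelˡ-⊏ k (kd∣ke , kd≢ke) = *-cancelˡ-∣ (suc k) kd∣ke , λ d≡e → kd≢ke (cong (suc k *_) d≡e)

  div-pos : ∀ {d n} → 1 ≤ n → d ∣ n → 1 ≤ n div d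
  div-pos {zero} 1≤n 0∣n with ∣⇒pos 1≤n 0∣n
  ... | ()
  div-pos {suc k} {n} 1≤n d∣n = n≢0⇒n>0 λ q≡0 →
    <⇒≢ 1≤n (sym (trans (sym (m*[n/m]≡n d∣n)) (trans (cong (suc k *_) q≡0) (*-zeroʳ (suc k)))))

  div-< : ∀ {d n} → 1 ≤ n → d ∣ n → d ≢ 1 → n div d < n
  div-< {zero} 1≤n 0∣n _ with ∣⇒pos 1≤n 0∣n
  ... | ()
  div-< {suc zero} _ _ 1≢1 = ⊥-elim (1≢1 refl)
  div-< {suc (suc _)} {suc n} _ _ _ = m/n<m (suc n) _ (s≤s (s≤s z≤n))

  map-*-div : ∀ k {xs} → All (suc k ∣_) xs → map (suc k *_) (map (_div suc k) xs) ≡ xs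
  map-*-div k [] = refl
  map-*-div k (p ∷ ps) = cong₂ _∷_ (m*[n/m]≡n p) (map-*-div k ps)

  nontrivialDivisors : ℕ → List ℕ
  nontrivialDivisors n = filter (λ d → ¬? (d ≟ 1)) (divisors n)

  ∈-divisors⁻ : ∀ {d n} → d ∈ divisors n → d ∣ n
  ∈-divisors⁻ {n = n} p = proj₂ (∈-filter⁻ (_∣? n) {xs = map suc (upTo n)} p)

  ∈-divisors⁺ : ∀ {d n} → 1 ≤ n → d ∣ n → d ∈ divisors n
  ∈-divisors⁺ {zero} 1≤n 0∣n with ∣⇒pos 1≤n 0∣n
  ... | ()
  ∈-divisors⁺ {suc d} {suc n} _ d∣n = ∈-filter⁺ (_∣? suc n) (∈-map⁺ suc (∈-upTo⁺ (∣⇒≤ d∣n))) d∣n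

  divisors-increasing : ∀ n → AllPairs _<_ (divisors n)
  divisors-increasing n =
    AllPairs.filter⁺ (_∣? n) (AllPairs.map⁺ (AllPairs.applyUpTo⁺₁ (λ i → i) n (λ i<j _ → s≤s i<j)))

  divisors-unique : ∀ n → Unique (divisors n)
  divisors-unique n = AllPairs.map <⇒≢ (divisors-increasing n)

  ∈-properDivisors⁻ : ∀ {d n} → d ∈ properDivisors n → d ⊏ n
  ∈-properDivisors⁻ {n = n} p with ∈-filter⁻ (λ d → ¬? (d ≟ n)) {xs = divisors n} p
  ... | d∈ , d≢n = ∈-divisors⁻ d∈ , d≢n

  ∈-properDivisors⁺ : ∀ {d n} → 1 ≤ n → d ⊏ n → d ∈ properDivisors n
  ∈-properDivisors⁺ {n = n} 1≤n (d∣n , d≢n) = ∈-filter⁺ (λ d → ¬? (d ≟ n)) (∈-divisors⁺ 1≤n d∣n) d≢n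

  properDivisors-unique : ∀ n → Unique (properDivisors n)
  properDivisors-unique n = Unique.filter⁺ (λ d → ¬? (d ≟ n)) (divisors-unique n)

  ∈-nontrivialDivisors⁻ : ∀ {d n} → d ∈ nontrivialDivisors n → d ∣ n × d ≢ 1
  ∈-nontrivialDivisors⁻ {n = n} p with ∈-filter⁻ (λ d → ¬? (d ≟ 1)) {xs = divisors n} p
  ... | d∈ , d≢1 = ∈-divisors⁻ d∈ , d≢1

  ∈-nontrivialDivisors⁺ : ∀ {d n} → 1 ≤ n → d ∣ n → d ≢ 1 → d ∈ nontrivialDivisors n
  ∈-nontrivialDivisors⁺ 1≤n d∣n d≢1 = ∈-filter⁺ (λ d → ¬? (d ≟ 1)) (∈-divisors⁺ 1≤n d∣n) d≢1

  nontrivialDivisors-unique : ∀ n → Unique (nontrivialDivisors n)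
  nontrivialDivisors-unique n = Unique.filter⁺ (λ d → ¬? (d ≟ 1)) (divisors-unique n)

  divisors≡1∷nontrivialDivisors : ∀ n → 1 ≤ n → divisors n ≡ 1 ∷ nontrivialDivisors n
  divisors≡1∷nontrivialDivisors (suc k) _ = trans divisors≡1∷rest (cong (1 ∷_) (sym nontrivial≡rest))
    where
    open ≡-Reasoning
    ≢1? = λ d → ¬? (d ≟ 1)
    rest = filter (_∣? suc k) (map suc (applyUpTo suc k))
    divisors≡1∷rest : divisors (suc k) ≡ 1 ∷ rest
    divisors≡1∷rest = filter-accept (_∣? suc k) (1∣ suc k)
    rest≢1 : ∀ {d} → d ∈ rest → d ≢ 1
    rest≢1 p d≡1 with ∈-map⁻ suc (proj₁ (∈-filter⁻ (_∣? suc k) {xs = map suc (applyUpTo suc k)} p))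
    ... | _ , i∈ , refl with ∈-applyUpTo⁻ suc i∈ | d≡1
    ...   | _ , _ , refl | ()
    nontrivial≡rest : nontrivialDivisors (suc k) ≡ rest
    nontrivial≡rest = begin
      filter ≢1? (divisors (suc k)) ≡⟨ cong (filter ≢1?) divisors≡1∷rest ⟩
      filter ≢1? (1 ∷ rest)         ≡⟨ filter-reject ≢1? {xs = rest} (λ 1≢1 → 1≢1 refl) ⟩
      filter ≢1? rest               ≡⟨ filter-all ≢1? {xs = rest} (All.tabulate rest≢1) ⟩
      rest                          ∎

  strictDivChain⇒Linked : ∀ c → T (strictDivChain c) → Linked _⊏_ c
  strictDivChain⇒Linked [] _ = []
  strictDivChain⇒Linked (d ∷ []) _ = [-]
  strictDivChain⇒Linked (d ∷ e ∷ c) t =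
    let d∣e , t′ = Equivalence.to T-∧ t
        d≢e , t″ = Equivalence.to T-∧ t′
    in (toWitness {a? = d ∣? e} d∣e , toWitnessFalse {a? = d ≟ e} d≢e) ∷ strictDivChain⇒Linked (e ∷ c) t″

  Linked⇒strictDivChain : ∀ {c} → Linked _⊏_ c → T (strictDivChain c)
  Linked⇒strictDivChain [] = _
  Linked⇒strictDivChain [-] = _
  Linked⇒strictDivChain {d ∷ e ∷ _} ((d∣e , d≢e) ∷ l) =
    Equivalence.from T-∧ (fromWitness {a? = d ∣? e} d∣e ,
      Equivalence.from T-∧ (fromWitnessFalse {a? = d ≟ e} d≢e , Linked⇒strictDivChain l))

  headIs⇒≡∷ : ∀ {a} c → T (headIs a c) → ∃[ c′ ] c ≡ a ∷ c′
  headIs⇒≡∷ {a} (d ∷ c) t = c , cong (_∷ c) (toWitness {a? = d ≟ a} t)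

  lastIs⇒≡∷ʳ : ∀ {a} c → T (lastIs a c) → ∃[ c′ ] c ≡ c′ ∷ʳ a
  lastIs⇒≡∷ʳ {a} (d ∷ []) t = [] , cong [_] (toWitness {a? = d ≟ a} t)
  lastIs⇒≡∷ʳ (d ∷ e ∷ c) t with lastIs⇒≡∷ʳ (e ∷ c) t
  ... | c′ , eq = d ∷ c′ , cong (d ∷_) eq

  lastIs-∷ʳ : ∀ {a} c → T (lastIs a (c ∷ʳ a))
  lastIs-∷ʳ {a} [] = fromWitness {a? = a ≟ a} refl
  lastIs-∷ʳ {a} (d ∷ []) = fromWitness {a? = a ≟ a} refl
  lastIs-∷ʳ (d ∷ e ∷ c) = lastIs-∷ʳ (e ∷ c)

  Linked-⊏⇒< : ∀ {c} → All (1 ≤_) c → Linked _⊏_ c → Linked _<_ c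
  Linked-⊏⇒< _ [] = []
  Linked-⊏⇒< _ [-] = [-]
  Linked-⊏⇒< (_ ∷ ps) (x⊏y ∷ l) = ⊏⇒< (All.head ps) x⊏y ∷ Linked-⊏⇒< ps l

  divisorChain∈sublists : ∀ {n c} → 1 ≤ n → Linked _⊏_ c → All (_∣ n) c → c ∈ sublists (divisors n)
  divisorChain∈sublists {n} 1≤n c↑ c∣n =
    sorted-⊆⇒∈sublists <-irrefl <-trans (divisors-increasing n)
      (Linked⇒AllPairs <-trans (Linked-⊏⇒< (All.map (∣⇒pos 1≤n) c∣n) c↑))
      (λ v∈c → ∈-divisors⁺ 1≤n (All.lookup c∣n v∈c))

  data ChainI (n : ℕ) : List ℕ → Set where
    chainI : ∀ {c} → Linked _⊏_ (1 ∷ c) → All (_∣ n) c → ChainI n (1 ∷ c)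

  data ChainII (n : ℕ) : List ℕ → Set where
    chainII : ∀ c → Linked _⊏_ (c ∷ʳ n) → ChainII n (c ∷ʳ n)

  ∈-chainsI⁻ : ∀ {n c} → c ∈ chainsI n → ChainI n c
  ∈-chainsI⁻ {n} {c} p with ∈-filter⁻ (λ c → T? (headIs 1 c ∧ strictDivChain c)) {xs = sublists (divisors n)} p
  ... | c∈ , t with Equivalence.to T-∧ t
  ... | h , s with headIs⇒≡∷ c h
  ... | _ , refl = chainI (strictDivChain⇒Linked _ s)
                     (All.tabulate (λ v∈ → ∈-divisors⁻ (sublists-⊆ (divisors n) c∈ (there v∈))))

  ∈-chainsI⁺ : ∀ {n c} → 1 ≤ n → ChainI n c → c ∈ chainsI n
  ∈-chainsI⁺ {n} 1≤n (chainI c↑ c∣n) =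
    ∈-filter⁺ (λ c → T? (headIs 1 c ∧ strictDivChain c)) (divisorChain∈sublists 1≤n c↑ (1∣ n ∷ c∣n))
      (Equivalence.from T-∧ (fromWitness {a? = 1 ≟ 1} refl , Linked⇒strictDivChain c↑))

  chainsI-unique : ∀ n → Unique (chainsI n)
  chainsI-unique n = Unique.filter⁺ (λ c → T? (headIs 1 c ∧ strictDivChain c)) (sublists-unique (divisors-unique n))

  ∈-chainsII⁻ : ∀ {n c} → c ∈ chainsII n → ChainII n c
  ∈-chainsII⁻ {n} {c} p with ∈-filter⁻ (λ c → T? (lastIs n c ∧ strictDivChain c)) {xs = sublists (divisors n)} p
  ... | _ , t with Equivalence.to T-∧ t
  ... | l , s with lastIs⇒≡∷ʳ c l
  ... | c′ , refl = chainII c′ (strictDivChain⇒Linked _ s)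

  ∈-chainsII⁺ : ∀ {n c} → 1 ≤ n → ChainII n c → c ∈ chainsII n
  ∈-chainsII⁺ {n} 1≤n (chainII c c↑) =
    ∈-filter⁺ (λ c → T? (lastIs n c ∧ strictDivChain c)) (divisorChain∈sublists 1≤n c↑ c∣n)
      (Equivalence.from T-∧ (lastIs-∷ʳ c , Linked⇒strictDivChain c↑))
    where
    c∣n : All (_∣ n) (c ∷ʳ n)
    c∣n = ∷ʳ⁺ (All.map proj₁ (AllPairs-∷ʳ⇒All c (Linked⇒AllPairs ⊏-trans c↑))) ∣-refl

  chainsII-unique : ∀ n → Unique (chainsII n)
  chainsII-unique n = Unique.filter⁺ (λ c → T? (lastIs n c ∧ strictDivChain c)) (sublists-unique (divisors-unique n))

  chainsII-via : ℕ → ℕ → List (List ℕ)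
  chainsII-via n d = map (_∷ʳ n) (chainsII d)

  chainsII-regrouping-unique : ∀ n → Unique ([ n ] ∷ concatMap (chainsII-via n) (properDivisors n))
  chainsII-regrouping-unique n =
    All.tabulate (λ v∈ → n∉ v∈) ∷ concatMap-unique (chainsII-via n) (properDivisors-unique n)
      (λ {d} _ → Unique.map⁺ (λ {x} {y} eq → proj₁ (∷ʳ-injective x y eq)) (chainsII-unique d)) penultimate
    where
    n∉ : ∀ {v} → v ∈ concatMap (chainsII-via n) (properDivisors n) → [ n ] ≢ v
    n∉ v∈ with ∈-concatMap⇒∃ (chainsII-via n) {xs = properDivisors n} v∈
    ... | d , _ , c∈ with ∈-map⁻ (_∷ʳ n) c∈
    ...   | c , c∈chainsII , refl with ∈-chainsII⁻ {d} c∈chainsII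
    ...     | chainII c _ = λ eq → []≢∷ʳ c (proj₁ (∷ʳ-injective [] (c ∷ʳ d) eq))
    penultimate : ∀ {d d′ v} → v ∈ chainsII-via n d → v ∈ chainsII-via n d′ → d ≡ d′
    penultimate {d} {d′} p q with ∈-map⁻ (_∷ʳ n) p | ∈-map⁻ (_∷ʳ n) q
    ... | c , c∈ , refl | c′ , c′∈ , eq with ∈-chainsII⁻ {d} c∈ | ∈-chainsII⁻ {d′} c′∈
    ...   | chainII x _ | chainII y _ = proj₂ (∷ʳ-injective x y (proj₁ (∷ʳ-injective _ _ eq)))

  chainsII-↭ : ∀ {n} → 1 ≤ n → chainsII n ↭ [ n ] ∷ concatMap (chainsII-via n) (properDivisors n)
  chainsII-↭ {n} 1≤n = unique∧set⇒↭ (chainsII-unique n) (chainsII-regrouping-unique n) split join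
    where
    split : chainsII n ⊆ [ n ] ∷ concatMap (chainsII-via n) (properDivisors n)
    split v∈ with ∈-chainsII⁻ {n} v∈
    ... | chainII c c↑ with initLast c
    ...   | [] = here refl
    ...   | c′ ∷ʳ′ d with Linked-∷ʳ⁻ c′ c↑
    ...     | c′↑ , d⊏n = there (∃⇒∈-concatMap (chainsII-via n) (∈-properDivisors⁺ 1≤n d⊏n)
                            (∈-map⁺ (_∷ʳ n) (∈-chainsII⁺ (∣⇒pos 1≤n (proj₁ d⊏n)) (chainII c′ c′↑))))
    join : [ n ] ∷ concatMap (chainsII-via n) (properDivisors n) ⊆ chainsII n
    join (here refl) = ∈-chainsII⁺ 1≤n (chainII [] [-])
    join (there v∈) with ∈-concatMap⇒∃ (chainsII-via n) {xs = properDivisors n} v∈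
    ... | d , d∈ , c∈ with ∈-map⁻ (_∷ʳ n) c∈
    ...   | c , c∈chainsII , refl with ∈-chainsII⁻ {d} c∈chainsII
    ...     | chainII c′ c′↑ =
      ∈-chainsII⁺ 1≤n (chainII (c′ ∷ʳ d) (Linked-∷ʳ⁺ c′ c′↑ (∈-properDivisors⁻ d∈)))

  dilate : ℕ → List ℕ → List ℕ
  dilate d c = 1 ∷ map (d *_) c

  dilate-chainI : ∀ {n d c} → 1 ≤ n → d ∣ n → d ≢ 1 → ChainI (n div d) c → ChainI n (dilate d c)
  dilate-chainI {d = zero} 1≤n 0∣n _ _ with ∣⇒pos 1≤n 0∣n
  ... | ()
  dilate-chainI {n} {suc k} _ d∣n d≢1 (chainI c↑ c∣n/d) =
    chainI (1⊏d ∷ Linked-map⁺ (Linked.map (*-monoʳ-⊏ k) c↑)) (All-map⁺ (All.map scale (1∣ _ ∷ c∣n/d)))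
    where
    1⊏d : 1 ⊏ suc k * 1
    1⊏d = 1∣ _ , λ 1≡d → d≢1 (sym (trans 1≡d (*-identityʳ (suc k))))
    scale : ∀ {x} → x ∣ n div suc k → suc k * x ∣ n
    scale x∣ = subst (_ ∣_) (m*[n/m]≡n d∣n) (*-monoʳ-∣ (suc k) x∣)

  undilate-chainI : ∀ {n e r} → 1 ≤ n → ChainI n (1 ∷ e ∷ r) →
    ∃[ c ] 1 ∷ e ∷ r ≡ dilate e c × ChainI (n div e) c
  undilate-chainI {n} {zero} 1≤n (chainI _ (0∣n ∷ _)) with ∣⇒pos 1≤n 0∣n
  ... | ()
  undilate-chainI {n} {suc k} {r} 1≤n (chainI (_ ∷ e↑r) (e∣n ∷ r∣n)) =
    1 ∷ q , cong (1 ∷_) e∷r≡ , chainI (Linked.map (*-cancelˡ-⊏ k) (Linked-map⁻ (subst (Linked _⊏_) e∷r≡ e↑r)))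
                                    (All.map cancel (All-map⁻ (subst (All (_∣ n)) r≡ r∣n)))
    where
    e = suc k
    q = map (_div e) r
    r≡ : r ≡ map (e *_) q
    r≡ = sym (map-*-div k (All.map proj₁ (AllPairs.head (Linked⇒AllPairs ⊏-trans e↑r))))
    e∷r≡ : e ∷ r ≡ e * 1 ∷ map (e *_) q
    e∷r≡ = cong₂ _∷_ (sym (*-identityʳ e)) r≡
    cancel : ∀ {x} → e * x ∣ n → x ∣ n div e
    cancel ex∣n = *-cancelˡ-∣ e (subst (_ ∣_) (sym (m*[n/m]≡n e∣n)) ex∣n)

  dilate-injective : ∀ {d c c′} → 1 ≤ d → dilate d c ≡ dilate d c′ → c ≡ c′
  dilate-injective {suc k} _ eq = map-injective (λ {x} {y} → *-cancelˡ-≡ x y (suc k)) (∷-injectiveʳ eq)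

  chainsI-via : ℕ → ℕ → List (List ℕ)
  chainsI-via n d = map (dilate d) (chainsI (n div d))

  chainsI-regrouping-unique : ∀ {n} → 1 ≤ n → Unique ([ 1 ] ∷ concatMap (chainsI-via n) (nontrivialDivisors n))
  chainsI-regrouping-unique {n} 1≤n =
    All.tabulate (λ v∈ → 1∉ v∈) ∷ concatMap-unique (chainsI-via n) (nontrivialDivisors-unique n)
      (λ {d} d∈ → Unique.map⁺ (dilate-injective (∣⇒pos 1≤n (proj₁ (∈-nontrivialDivisors⁻ {n = n} d∈))))
                                (chainsI-unique (n div d)))
      second
    where
    1∉ : ∀ {v} → v ∈ concatMap (chainsI-via n) (nontrivialDivisors n) → [ 1 ] ≢ v
    1∉ v∈ with ∈-concatMap⇒∃ (chainsI-via n) {xs = nontrivialDivisors n} v∈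
    ... | d , _ , c∈ with ∈-map⁻ (dilate d) c∈
    ...   | c , c∈chainsI , refl with ∈-chainsI⁻ {n div d} c∈chainsI
    ...     | chainI _ _ = λ ()
    second : ∀ {d d′ v} → v ∈ chainsI-via n d → v ∈ chainsI-via n d′ → d ≡ d′
    second {d} {d′} p q with ∈-map⁻ (dilate d) p | ∈-map⁻ (dilate d′) q
    ... | c , c∈ , refl | c′ , c′∈ , eq with ∈-chainsI⁻ {n div d} c∈ | ∈-chainsI⁻ {n div d′} c′∈
    ...   | chainI _ _ | chainI _ _ =
      trans (sym (*-identityʳ d)) (trans (∷-injectiveˡ (∷-injectiveʳ eq)) (*-identityʳ d′))

  chainsI-↭ : ∀ {n} → 1 ≤ n → chainsI n ↭ [ 1 ] ∷ concatMap (chainsI-via n) (nontrivialDivisors n)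
  chainsI-↭ {n} 1≤n = unique∧set⇒↭ (chainsI-unique n) (chainsI-regrouping-unique 1≤n) split join
    where
    split : chainsI n ⊆ [ 1 ] ∷ concatMap (chainsI-via n) (nontrivialDivisors n)
    split v∈ with ∈-chainsI⁻ {n} v∈
    ... | chainI [-] _ = here refl
    ... | ch@(chainI {e ∷ _} ((_ , 1≢e) ∷ _) (e∣n ∷ _)) with undilate-chainI 1≤n ch
    ...   | c , eq , c-chain rewrite eq =
      there (∃⇒∈-concatMap (chainsI-via n) (∈-nontrivialDivisors⁺ 1≤n e∣n (λ e≡1 → 1≢e (sym e≡1)))
               (∈-map⁺ (dilate e) (∈-chainsI⁺ (div-pos 1≤n e∣n) c-chain)))
    join : [ 1 ] ∷ concatMap (chainsI-via n) (nontrivialDivisors n) ⊆ chainsI n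
    join (here refl) = ∈-chainsI⁺ 1≤n (chainI [-] [])
    join (there v∈) with ∈-concatMap⇒∃ (chainsI-via n) {xs = nontrivialDivisors n} v∈
    ... | d , d∈ , c∈ with ∈-map⁻ (dilate d) c∈ | ∈-nontrivialDivisors⁻ {n = n} d∈
    ...   | c , c∈chainsI , refl | d∣n , d≢1 =
      ∈-chainsI⁺ 1≤n (dilate-chainI 1≤n d∣n d≢1 (∈-chainsI⁻ {n div d} c∈chainsI))

open DivisorChains

module SeriesAlgebra {c ℓ : Level} (R : CommutativeRing c ℓ) where

  open import Data.Empty using (⊥-elim)
  open import Data.List using (List; []; _∷_; map; foldr; applyUpTo; _++_; concatMap)
  open import Data.List.Membership.Propositional using (_∈_)
  open import Data.List.Relation.Binary.Permutation.Propositional as ↭ using (_↭_)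
  open import Data.List.Relation.Unary.Any using (here; there)
  open import Data.Nat as ℕ using (ℕ; zero; suc; _∸_; _≤_; _<_; z≤n; s≤s)
  open import Data.Nat.Divisibility
    using (_∣_; _∣?_; divides; 1∣_; *-monoˡ-∣; n∣m*n; ∣m+n∣m⇒∣n; ∣⇒≤; ∣-refl; ∣m∸n∣n⇒∣m)
  open import Data.Nat.DivMod using (m*n/n≡m; m/n/o≡m/[n*o])
  open import Data.Nat.Properties as ℕ using ()
  open import Relation.Binary.Bundles using (Setoid)
  import Relation.Binary.Reasoning.Setoid
  open import Relation.Binary.PropositionalEquality as ≡ using (_≡_)
  open import Relation.Nullary using (¬_; Dec; yes; no)

  open CommutativeRing R
  open PowerSeries R
  open import Algebra.Properties.Ring ring using (-‿distribʳ-*)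
  open import Algebra.Properties.AbelianGroup +-abelianGroup using (⁻¹-∙-comm)
  open import Algebra.Properties.Group +-group using (ε⁻¹≈ε)
  open import Algebra.Properties.CommutativeSemigroup +-commutativeSemigroup using (interchange)
  module ≈-Reasoning = Relation.Binary.Reasoning.Setoid setoid

  ∑ : ℕ → (ℕ → Carrier) → Carrier
  ∑ zero f = 0#
  ∑ (suc n) f = f 0 + ∑ n (λ i → f (suc i))

  foldr-applyUpTo : ∀ {a} {A : Set a} (f : A → Carrier) (g : ℕ → A) n →
    foldr _+_ 0# (map f (applyUpTo g n)) ≡ ∑ n (λ i → f (g i))
  foldr-applyUpTo f g zero = ≡.refl
  foldr-applyUpTo f g (suc n) = ≡.cong (f (g 0) +_) (foldr-applyUpTo f (λ i → g (suc i)) n)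

  ∑-cong : ∀ n {f g : ℕ → Carrier} → (∀ i → i < n → f i ≈ g i) → ∑ n f ≈ ∑ n g
  ∑-cong zero _ = refl
  ∑-cong (suc n) f≈g = +-cong (f≈g 0 (s≤s z≤n)) (∑-cong n (λ i i<n → f≈g (suc i) (s≤s i<n)))

  ∑-zero : ∀ n {f : ℕ → Carrier} → (∀ i → i < n → f i ≈ 0#) → ∑ n f ≈ 0#
  ∑-zero n f≈0 = trans (∑-cong n f≈0) (∑-0 n)
    where
    ∑-0 : ∀ n → ∑ n (λ _ → 0#) ≈ 0#
    ∑-0 zero = refl
    ∑-0 (suc n) = trans (+-identityˡ _) (∑-0 n)

  ∑-snoc : ∀ n (f : ℕ → Carrier) → ∑ (suc n) f ≈ ∑ n f + f n
  ∑-snoc zero f = trans (+-identityʳ (f 0)) (sym (+-identityˡ (f 0)))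
  ∑-snoc (suc n) f = trans (+-congˡ (∑-snoc n (λ i → f (suc i)))) (sym (+-assoc _ _ _))

  ∑-split : ∀ m n (f : ℕ → Carrier) → ∑ (m ℕ.+ n) f ≈ ∑ m f + ∑ n (λ i → f (m ℕ.+ i))
  ∑-split zero n f = sym (+-identityˡ _)
  ∑-split (suc m) n f = trans (+-congˡ (∑-split m n (λ i → f (suc i)))) (sym (+-assoc _ _ _))

  ∑-+ : ∀ n (f g : ℕ → Carrier) → ∑ n (λ i → f i + g i) ≈ ∑ n f + ∑ n g
  ∑-+ zero f g = sym (+-identityˡ 0#)
  ∑-+ (suc n) f g = trans (+-congˡ (∑-+ n _ _)) (interchange _ _ _ _)

  ∑-*ˡ : ∀ n a (f : ℕ → Carrier) → a * ∑ n f ≈ ∑ n (λ i → a * f i)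
  ∑-*ˡ zero a f = zeroʳ a
  ∑-*ˡ (suc n) a f = trans (distribˡ a _ _) (+-congˡ (∑-*ˡ n a _))

  ∑-neg : ∀ n (f : ℕ → Carrier) → - ∑ n f ≈ ∑ n (λ i → - f i)
  ∑-neg zero f = ε⁻¹≈ε
  ∑-neg (suc n) f = trans (sym (⁻¹-∙-comm _ _)) (+-congˡ (∑-neg n (λ i → f (suc i))))

  ∑-reverse : ∀ n (f : ℕ → Carrier) → ∑ n f ≈ ∑ n (λ i → f (n ∸ suc i))
  ∑-reverse zero f = refl
  ∑-reverse (suc n) f = begin
    f 0 + ∑ n (λ i → f (suc i))             ≈⟨ +-congˡ (∑-reverse n (λ i → f (suc i))) ⟩
    f 0 + ∑ n (λ i → f (suc (n ∸ suc i)))   ≈⟨ +-comm _ _ ⟩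
    ∑ n (λ i → f (suc (n ∸ suc i))) + f 0   ≈⟨ +-cong (∑-cong n (λ i i<n → reflexive (≡.cong f (≡.sym (ℕ.+-∸-assoc 1 i<n)))))
                                                       (reflexive (≡.cong f (≡.sym (ℕ.n∸n≡0 n)))) ⟩
    ∑ n (λ i → f (n ∸ i)) + f (n ∸ n)       ≈⟨ ∑-snoc n (λ i → f (suc n ∸ suc i)) ⟨
    ∑ (suc n) (λ i → f (suc n ∸ suc i))     ∎
    where open ≈-Reasoning

  ∑-multiples : ∀ k q (h : ℕ → Carrier) → (∀ j → ¬ (suc k ∣ j) → h j ≈ 0#) →
    ∑ (q ℕ.* suc k) h ≈ ∑ q (λ i → h (i ℕ.* suc k))
  ∑-multiples k zero h _ = refl
  ∑-multiples k (suc q) h h≈0 = begin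
    ∑ (suc k ℕ.+ q ℕ.* suc k) h                                     ≈⟨ ∑-split (suc k) (q ℕ.* suc k) h ⟩
    ∑ (suc k) h + ∑ (q ℕ.* suc k) (λ i → h (suc k ℕ.+ i))           ≈⟨ +-cong (+-congˡ (∑-zero k between))
                                                                                (∑-multiples k q _ shifted≈0) ⟩
    (h 0 + 0#) + ∑ q (λ i → h (suc k ℕ.+ i ℕ.* suc k))              ≈⟨ +-congʳ (+-identityʳ _) ⟩
    ∑ (suc q) (λ i → h (i ℕ.* suc k))                               ∎
    where
    open ≈-Reasoning
    between : ∀ i → i < k → h (suc i) ≈ 0#
    between i i<k = h≈0 (suc i) (λ d∣ → ℕ.<⇒≱ (s≤s i<k) (∣⇒≤ d∣))
    shifted≈0 : ∀ j → ¬ (suc k ∣ j) → h (suc k ℕ.+ j) ≈ 0#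
    shifted≈0 j d∤j = h≈0 (suc k ℕ.+ j) (λ d∣ → d∤j (∣m+n∣m⇒∣n d∣ ∣-refl))

  ≋-setoid : Setoid c ℓ
  ≋-setoid = record
    { Carrier = Series
    ; _≈_ = _≋_
    ; isEquivalence = record
      { refl = λ _ → refl
      ; sym = λ f≋g m → sym (f≋g m)
      ; trans = λ f≋g g≋h m → trans (f≋g m) (g≋h m)
      }
    }

  open Setoid ≋-setoid public using () renaming (refl to ≋-refl; reflexive to ≋-reflexive; sym to ≋-sym; trans to ≋-trans)
  module ≋-Reasoning = Relation.Binary.Reasoning.Setoid ≋-setoid

  0S : Series
  0S _ = 0#

  ⊕-cong : ∀ {f f′ g g′} → f ≋ f′ → g ≋ g′ → (f ⊕ g) ≋ (f′ ⊕ g′)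
  ⊕-cong f≋ g≋ m = +-cong (f≋ m) (g≋ m)

  ⊖-cong : ∀ {f f′} → f ≋ f′ → (⊖ f) ≋ (⊖ f′)
  ⊖-cong f≋ m = -‿cong (f≋ m)

  signed-cong : ∀ k {f g} → f ≋ g → signed k f ≋ signed k g
  signed-cong zero f≋g = f≋g
  signed-cong (suc k) f≋g = ⊖-cong (signed-cong k f≋g)

  ⊛-∑ : ∀ f g m → (f ⊛ g) m ≈ ∑ (suc m) (λ i → f i * g (m ∸ i))
  ⊛-∑ f g m = reflexive (foldr-applyUpTo (λ i → f i * g (m ∸ i)) (λ i → i) (suc m))

  ⊕-transpose : ∀ {f g h} → f ≋ (g ⊕ h) → g ≋ (f ⊕ (⊖ h))
  ⊕-transpose {f} {g} {h} f≋g⊕h m = begin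
    g m                    ≈⟨ +-identityʳ (g m) ⟨
    g m + 0#               ≈⟨ +-congˡ (-‿inverseʳ (h m)) ⟨
    g m + (h m + - h m)    ≈⟨ +-assoc (g m) (h m) (- h m) ⟨
    (g m + h m) + - h m    ≈⟨ +-congʳ (f≋g⊕h m) ⟨
    f m + - h m            ∎
    where open ≈-Reasoning

  ⊛-cong : ∀ {f f′ g g′} → f ≋ f′ → g ≋ g′ → (f ⊛ g) ≋ (f′ ⊛ g′)
  ⊛-cong {f} {f′} {g} {g′} f≋ g≋ m = begin
    (f ⊛ g) m                             ≈⟨ ⊛-∑ f g m ⟩
    ∑ (suc m) (λ i → f i * g (m ∸ i))     ≈⟨ ∑-cong (suc m) (λ i _ → *-cong (f≋ i) (g≋ (m ∸ i))) ⟩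
    ∑ (suc m) (λ i → f′ i * g′ (m ∸ i))   ≈⟨ ⊛-∑ f′ g′ m ⟨
    (f′ ⊛ g′) m                           ∎
    where open ≈-Reasoning

  ⊛-comm : ∀ f g → (f ⊛ g) ≋ (g ⊛ f)
  ⊛-comm f g m = begin
    (f ⊛ g) m                                         ≈⟨ ⊛-∑ f g m ⟩
    ∑ (suc m) (λ i → f i * g (m ∸ i))                 ≈⟨ ∑-reverse (suc m) (λ i → f i * g (m ∸ i)) ⟩
    ∑ (suc m) (λ i → f (m ∸ i) * g (m ∸ (m ∸ i)))     ≈⟨ ∑-cong (suc m) swap ⟩
    ∑ (suc m) (λ i → g i * f (m ∸ i))                 ≈⟨ ⊛-∑ g f m ⟨
    (g ⊛ f) m                                         ∎
    where
    open ≈-Reasoning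
    swap : ∀ i → i < suc m → f (m ∸ i) * g (m ∸ (m ∸ i)) ≈ g i * f (m ∸ i)
    swap i (s≤s i≤m) = trans (*-comm _ _) (*-congʳ (reflexive (≡.cong g (ℕ.m∸[m∸n]≡n i≤m))))

  𝟙-⊛ : ∀ f → (𝟙 ⊛ f) ≋ f
  𝟙-⊛ f m = begin
    (𝟙 ⊛ f) m                                   ≈⟨ ⊛-∑ 𝟙 f m ⟩
    1# * f m + ∑ m (λ i → 0# * f (m ∸ suc i))   ≈⟨ +-cong (*-identityˡ _) (∑-zero m (λ i _ → zeroˡ _)) ⟩
    f m + 0#                                    ≈⟨ +-identityʳ _ ⟩
    f m                                         ∎
    where open ≈-Reasoning

  ⊛-𝟙 : ∀ f → (f ⊛ 𝟙) ≋ f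
  ⊛-𝟙 f = ≋-trans (⊛-comm f 𝟙) (𝟙-⊛ f)

  ⊛-distribˡ : ∀ f g h → (f ⊛ (g ⊕ h)) ≋ ((f ⊛ g) ⊕ (f ⊛ h))
  ⊛-distribˡ f g h m = begin
    (f ⊛ (g ⊕ h)) m                                                           ≈⟨ ⊛-∑ f (g ⊕ h) m ⟩
    ∑ (suc m) (λ i → f i * (g (m ∸ i) + h (m ∸ i)))
      ≈⟨ ∑-cong (suc m) (λ i _ → distribˡ (f i) (g (m ∸ i)) (h (m ∸ i))) ⟩
    ∑ (suc m) (λ i → f i * g (m ∸ i) + f i * h (m ∸ i))
      ≈⟨ ∑-+ (suc m) (λ i → f i * g (m ∸ i)) (λ i → f i * h (m ∸ i)) ⟩
    ∑ (suc m) (λ i → f i * g (m ∸ i)) + ∑ (suc m) (λ i → f i * h (m ∸ i))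
      ≈⟨ +-cong (⊛-∑ f g m) (⊛-∑ f h m) ⟨
    ((f ⊛ g) ⊕ (f ⊛ h)) m                                                     ∎
    where open ≈-Reasoning

  ⊛-distribʳ : ∀ f g h → ((g ⊕ h) ⊛ f) ≋ ((g ⊛ f) ⊕ (h ⊛ f))
  ⊛-distribʳ f g h = ≋-trans (⊛-comm _ f) (≋-trans (⊛-distribˡ f g h) (⊕-cong (⊛-comm f g) (⊛-comm f h)))

  ⊛-zeroʳ : ∀ f → (f ⊛ 0S) ≋ 0S
  ⊛-zeroʳ f m = trans (⊛-∑ f 0S m) (∑-zero (suc m) (λ i _ → zeroʳ (f i)))

  ⊛-⊖ : ∀ f g → (f ⊛ (⊖ g)) ≋ (⊖ (f ⊛ g))
  ⊛-⊖ f g m = begin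
    (f ⊛ (⊖ g)) m                           ≈⟨ ⊛-∑ f (⊖ g) m ⟩
    ∑ (suc m) (λ i → f i * - g (m ∸ i))     ≈⟨ ∑-cong (suc m) (λ i _ → sym (-‿distribʳ-* (f i) (g (m ∸ i)))) ⟩
    ∑ (suc m) (λ i → - (f i * g (m ∸ i)))   ≈⟨ ∑-neg (suc m) (λ i → f i * g (m ∸ i)) ⟨
    - ∑ (suc m) (λ i → f i * g (m ∸ i))     ≈⟨ -‿cong (⊛-∑ f g m) ⟨
    (⊖ (f ⊛ g)) m                           ∎
    where open ≈-Reasoning

  ⊛-signed : ∀ k f g → (f ⊛ signed k g) ≋ signed k (f ⊛ g)
  ⊛-signed zero f g = ≋-refl
  ⊛-signed (suc k) f g = ≋-trans (⊛-⊖ f _) (⊖-cong (⊛-signed k f g))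

  shift : Series → Series
  shift f m = f (suc m)

  infixr 7 _·_
  _·_ : Carrier → Series → Series
  (a · f) m = a * f m

  ⊛-at-0 : ∀ f g → (f ⊛ g) 0 ≈ f 0 * g 0
  ⊛-at-0 f g = trans (⊛-∑ f g 0) (+-identityʳ _)

  shift-⊛ : ∀ f g → shift (f ⊛ g) ≋ ((f 0 · shift g) ⊕ (shift f ⊛ g))
  shift-⊛ f g k = trans (⊛-∑ f g (suc k)) (+-congˡ (sym (⊛-∑ (shift f) g k)))

  ·-⊛ : ∀ a f g → ((a · f) ⊛ g) ≋ (a · (f ⊛ g))
  ·-⊛ a f g m = begin
    ((a · f) ⊛ g) m                           ≈⟨ ⊛-∑ (a · f) g m ⟩
    ∑ (suc m) (λ i → (a * f i) * g (m ∸ i))   ≈⟨ ∑-cong (suc m) (λ i _ → *-assoc a (f i) (g (m ∸ i))) ⟩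
    ∑ (suc m) (λ i → a * (f i * g (m ∸ i)))   ≈⟨ ∑-*ˡ (suc m) a (λ i → f i * g (m ∸ i)) ⟨
    a * ∑ (suc m) (λ i → f i * g (m ∸ i))     ≈⟨ *-congˡ (⊛-∑ f g m) ⟨
    (a · (f ⊛ g)) m                           ∎
    where open ≈-Reasoning

  -- Induction on the coefficient index, peeling off the constant term of f.
  ⊛-assoc : ∀ f g h → ((f ⊛ g) ⊛ h) ≋ (f ⊛ (g ⊛ h))
  ⊛-assoc f g h zero = begin
    ((f ⊛ g) ⊛ h) 0       ≈⟨ trans (⊛-at-0 (f ⊛ g) h) (*-congʳ (⊛-at-0 f g)) ⟩
    (f 0 * g 0) * h 0     ≈⟨ *-assoc (f 0) (g 0) (h 0) ⟩
    f 0 * (g 0 * h 0)     ≈⟨ trans (⊛-at-0 f (g ⊛ h)) (*-congˡ (⊛-at-0 g h)) ⟨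
    (f ⊛ (g ⊛ h)) 0       ∎
    where open ≈-Reasoning
  ⊛-assoc f g h (suc k) = begin
    ((f ⊛ g) ⊛ h) (suc k)
      ≈⟨ shift-⊛ (f ⊛ g) h k ⟩
    (f ⊛ g) 0 * h (suc k) + (shift (f ⊛ g) ⊛ h) k
      ≈⟨ +-cong (*-congʳ (⊛-at-0 f g)) (⊛-cong (shift-⊛ f g) (≋-refl {h}) k) ⟩
    (f 0 * g 0) * h (suc k) + (((f 0 · shift g) ⊕ (shift f ⊛ g)) ⊛ h) k
      ≈⟨ +-cong (*-assoc _ _ _) (⊛-distribʳ h (f 0 · shift g) (shift f ⊛ g) k) ⟩
    f 0 * (g 0 * h (suc k)) + (((f 0 · shift g) ⊛ h) k + ((shift f ⊛ g) ⊛ h) k)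
      ≈⟨ +-congˡ (+-cong (·-⊛ (f 0) (shift g) h k) (⊛-assoc (shift f) g h k)) ⟩
    f 0 * (g 0 * h (suc k)) + (f 0 * (shift g ⊛ h) k + (shift f ⊛ (g ⊛ h)) k)
      ≈⟨ +-assoc _ _ _ ⟨
    (f 0 * (g 0 * h (suc k)) + f 0 * (shift g ⊛ h) k) + (shift f ⊛ (g ⊛ h)) k
      ≈⟨ +-congʳ (trans (*-congˡ (shift-⊛ g h k)) (distribˡ _ _ _)) ⟨
    f 0 * (g ⊛ h) (suc k) + (shift f ⊛ (g ⊛ h)) k
      ≈⟨ shift-⊛ f (g ⊛ h) k ⟨
    (f ⊛ (g ⊛ h)) (suc k)
      ∎
    where open ≈-Reasoning

  ⊛-exchange : ∀ f g h → (f ⊛ (g ⊛ h)) ≋ (g ⊛ (f ⊛ h))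
  ⊛-exchange f g h = ≋-trans (≋-sym (⊛-assoc f g h)) (≋-trans (⊛-cong (⊛-comm f g) ≋-refl) (⊛-assoc g f h))

  ΣS-cong : ∀ {a} {A : Set a} (xs : List A) {f g : A → Series} →
    (∀ {x} → x ∈ xs → f x ≋ g x) → ΣS (map f xs) ≋ ΣS (map g xs)
  ΣS-cong [] _ = ≋-refl
  ΣS-cong (x ∷ xs) f≋g = ⊕-cong (f≋g (here ≡.refl)) (ΣS-cong xs (λ x∈ → f≋g (there x∈)))

  ΣS-map : ∀ {a b} {A : Set a} {B : Set b} (f : B → Series) (g : A → B) xs →
    ΣS (map f (map g xs)) ≋ ΣS (map (λ x → f (g x)) xs)
  ΣS-map f g [] = ≋-refl
  ΣS-map f g (x ∷ xs) = ⊕-cong ≋-refl (ΣS-map f g xs)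

  ΣS-++ : ∀ {a} {A : Set a} (f : A → Series) xs ys → ΣS (map f (xs ++ ys)) ≋ (ΣS (map f xs) ⊕ ΣS (map f ys))
  ΣS-++ f [] ys m = sym (+-identityˡ _)
  ΣS-++ f (x ∷ xs) ys m = trans (+-congˡ (ΣS-++ f xs ys m)) (sym (+-assoc _ _ _))

  ΣS-concatMap : ∀ {a b} {A : Set a} {B : Set b} (f : B → Series) (g : A → List B) xs →
    ΣS (map f (concatMap g xs)) ≋ ΣS (map (λ x → ΣS (map f (g x))) xs)
  ΣS-concatMap f g [] = ≋-refl
  ΣS-concatMap f g (x ∷ xs) = ≋-trans (ΣS-++ f (g x) (concatMap g xs)) (⊕-cong ≋-refl (ΣS-concatMap f g xs))

  ΣS-↭ : ∀ {a} {A : Set a} (f : A → Series) {xs ys} → xs ↭ ys → ΣS (map f xs) ≋ ΣS (map f ys)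
  ΣS-↭ f ↭.refl = ≋-refl
  ΣS-↭ f (↭.prep x p) = ⊕-cong ≋-refl (ΣS-↭ f p)
  ΣS-↭ f (↭.swap x y p) m = trans (sym (+-assoc _ _ _)) (trans (+-cong (+-comm _ _) (ΣS-↭ f p m)) (+-assoc _ _ _))
  ΣS-↭ f (↭.trans p q) = ≋-trans (ΣS-↭ f p) (ΣS-↭ f q)

  ⊛-ΣS : ∀ {a} {A : Set a} f (g : A → Series) xs → (f ⊛ ΣS (map g xs)) ≋ ΣS (map (λ x → f ⊛ g x) xs)
  ⊛-ΣS f g [] = ⊛-zeroʳ f
  ⊛-ΣS f g (x ∷ xs) = ≋-trans (⊛-distribˡ f (g x) _) (⊕-cong ≋-refl (⊛-ΣS f g xs))

  ΣS-⊛ : ∀ {a} {A : Set a} f (g : A → Series) xs → (ΣS (map g xs) ⊛ f) ≋ ΣS (map (λ x → g x ⊛ f) xs)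
  ΣS-⊛ f g xs = ≋-trans (⊛-comm _ f) (≋-trans (⊛-ΣS f g xs) (ΣS-cong xs (λ {x} _ → ⊛-comm f (g x))))

  ⊖-ΣS : ∀ {a} {A : Set a} (g : A → Series) xs → (⊖ ΣS (map g xs)) ≋ ΣS (map (λ x → ⊖ g x) xs)
  ⊖-ΣS g [] m = ε⁻¹≈ε
  ⊖-ΣS g (x ∷ xs) m = trans (sym (⁻¹-∙-comm _ _)) (+-congˡ (⊖-ΣS g xs m))

  sub-∤ : ∀ d f {m} → ¬ (d ∣ m) → sub d f m ≈ 0#
  sub-∤ d f {m} d∤m with d ∣? m
  ... | yes d∣m = ⊥-elim (d∤m d∣m)
  ... | no _ = refl

  sub-* : ∀ k f q → sub (suc k) f (q ℕ.* suc k) ≈ f q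
  sub-* k f q with suc k ∣? q ℕ.* suc k
  ... | yes _ = reflexive (≡.cong f (m*n/n≡m q (suc k)))
  ... | no d∤ = ⊥-elim (d∤ (n∣m*n q))

  sub-unique : ∀ k f h → (∀ q → h (q ℕ.* suc k) ≈ f q) → (∀ {m} → ¬ (suc k ∣ m) → h m ≈ 0#) →
    sub (suc k) f ≋ h
  sub-unique k f h on off m with suc k ∣? m
  ... | yes (divides q ≡.refl) = trans (reflexive (≡.cong f (m*n/n≡m q (suc k)))) (sym (on q))
  ... | no d∤m = sym (off d∤m)

  sub-cong : ∀ d {f g} → f ≋ g → sub d f ≋ sub d g
  sub-cong d f≋g m with d ∣? m
  ... | yes _ = f≋g _
  ... | no _ = refl

  sub-⊕ : ∀ d f g → sub d (f ⊕ g) ≋ (sub d f ⊕ sub d g)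
  sub-⊕ d f g m with d ∣? m
  ... | yes _ = refl
  ... | no _ = sym (+-identityˡ 0#)

  sub-⊖ : ∀ d f → sub d (⊖ f) ≋ (⊖ sub d f)
  sub-⊖ d f m with d ∣? m
  ... | yes _ = refl
  ... | no _ = sym ε⁻¹≈ε

  sub-signed : ∀ d k f → sub d (signed k f) ≋ signed k (sub d f)
  sub-signed d zero f = ≋-refl
  sub-signed d (suc k) f = ≋-trans (sub-⊖ d _) (⊖-cong (sub-signed d k f))

  sub-ΣS : ∀ {a} {A : Set a} d (g : A → Series) xs → sub d (ΣS (map g xs)) ≋ ΣS (map (λ x → sub d (g x)) xs)
  sub-ΣS d g [] m with d ∣? m
  ... | yes _ = refl
  ... | no _ = refl
  sub-ΣS d g (x ∷ xs) = ≋-trans (sub-⊕ d (g x) _) (⊕-cong ≋-refl (sub-ΣS d g xs))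

  sub-1 : ∀ f → sub 1 f ≋ f
  sub-1 f = sub-unique 0 f f (λ q → reflexive (≡.cong f (ℕ.*-identityʳ q))) (λ 1∤m → ⊥-elim (1∤m (1∣ _)))

  sub-𝟙 : ∀ k → sub (suc k) 𝟙 ≋ 𝟙
  sub-𝟙 k = sub-unique k 𝟙 𝟙 on off
    where
    on : ∀ q → 𝟙 (q ℕ.* suc k) ≈ 𝟙 q
    on zero = refl
    on (suc q) = refl
    off : ∀ {m} → ¬ (suc k ∣ m) → 𝟙 m ≈ 0#
    off {zero} d∤0 = ⊥-elim (d∤0 (divides 0 ≡.refl))
    off {suc m} _ = refl

  sub-sub : ∀ k l f → sub (suc k) (sub (suc l) f) ≋ sub (suc k ℕ.* suc l) f
  sub-sub k l f = ≋-sym (sub-unique (l ℕ.+ k ℕ.* suc l) f (sub (suc k) (sub (suc l) f)) on off)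
    where
    on : ∀ q → sub (suc k) (sub (suc l) f) (q ℕ.* (suc k ℕ.* suc l)) ≈ f q
    on q = begin
      sub (suc k) (sub (suc l) f) (q ℕ.* (suc k ℕ.* suc l))   ≡⟨ ≡.cong (sub (suc k) (sub (suc l) f)) (reorder q) ⟩
      sub (suc k) (sub (suc l) f) (q ℕ.* suc l ℕ.* suc k)     ≈⟨ sub-* k _ (q ℕ.* suc l) ⟩
      sub (suc l) f (q ℕ.* suc l)                             ≈⟨ sub-* l f q ⟩
      f q                                                     ∎
      where
      open ≈-Reasoning
      reorder : ∀ q → q ℕ.* (suc k ℕ.* suc l) ≡ q ℕ.* suc l ℕ.* suc k
      reorder q = ≡.trans (≡.cong (q ℕ.*_) (ℕ.*-comm (suc k) (suc l))) (≡.sym (ℕ.*-assoc q (suc l) (suc k)))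
    off : ∀ {m} → ¬ (suc k ℕ.* suc l ∣ m) → sub (suc k) (sub (suc l) f) m ≈ 0#
    off {m} kl∤m with suc k ∣? m
    ... | no _ = refl
    ... | yes (divides p ≡.refl) with suc l ∣? (p ℕ.* suc k) ℕ./ suc k
    ...   | no _ = refl
    ...   | yes l∣p′ = ⊥-elim (kl∤m (≡.subst (_∣ p ℕ.* suc k) (ℕ.*-comm (suc l) (suc k))
                                     (*-monoˡ-∣ (suc k) (≡.subst (suc l ∣_) (m*n/n≡m p (suc k)) l∣p′))))

  sub-div-* : ∀ (F : ℕ → Series) n {d e} → 1 ≤ d → 1 ≤ e →
    sub (d ℕ.* e) (F (n div (d ℕ.* e))) ≋ sub d (sub e (F ((n div d) div e)))
  sub-div-* F n {suc k} {suc l} _ _ = begin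
    sub (suc k ℕ.* suc l) (F (n div (suc k ℕ.* suc l)))
      ≡⟨ ≡.cong (λ q → sub (suc k ℕ.* suc l) (F q)) (m/n/o≡m/[n*o] n (suc k) (suc l)) ⟨
    sub (suc k ℕ.* suc l) (F ((n div suc k) div suc l))
      ≈⟨ sub-sub k l _ ⟨
    sub (suc k) (sub (suc l) (F ((n div suc k) div suc l)))
      ∎
    where open ≋-Reasoning

  sub-⊛ : ∀ k f g → sub (suc k) (f ⊛ g) ≋ (sub (suc k) f ⊛ sub (suc k) g)
  sub-⊛ k f g = sub-unique k (f ⊛ g) (sub D f ⊛ sub D g) on off
    where
    D = suc k
    H : ℕ → ℕ → Carrier
    H m j = sub D f j * sub D g (m ∸ j)
    on : ∀ q → (sub D f ⊛ sub D g) (q ℕ.* D) ≈ (f ⊛ g) q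
    on q = begin
      (sub D f ⊛ sub D g) (q ℕ.* D)                      ≈⟨ ⊛-∑ (sub D f) (sub D g) (q ℕ.* D) ⟩
      ∑ (suc (q ℕ.* D)) (H (q ℕ.* D))                    ≈⟨ ∑-snoc (q ℕ.* D) (H (q ℕ.* D)) ⟩
      ∑ (q ℕ.* D) (H (q ℕ.* D)) + H (q ℕ.* D) (q ℕ.* D)  ≈⟨ +-congʳ (∑-multiples k q (H (q ℕ.* D)) H-off) ⟩
      ∑ q (λ i → H (q ℕ.* D) (i ℕ.* D)) + H (q ℕ.* D) (q ℕ.* D)
                                                         ≈⟨ ∑-snoc q (λ i → H (q ℕ.* D) (i ℕ.* D)) ⟨
      ∑ (suc q) (λ i → H (q ℕ.* D) (i ℕ.* D))            ≈⟨ ∑-cong (suc q) (λ i _ → *-cong (sub-* k f i) (sub-*-∸ i)) ⟩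
      ∑ (suc q) (λ i → f i * g (q ∸ i))                  ≈⟨ ⊛-∑ f g q ⟨
      (f ⊛ g) q                                          ∎
      where
      open ≈-Reasoning
      H-off : ∀ j → ¬ (D ∣ j) → H (q ℕ.* D) j ≈ 0#
      H-off j d∤j = trans (*-congʳ (sub-∤ D f d∤j)) (zeroˡ _)
      sub-*-∸ : ∀ i → sub D g (q ℕ.* D ∸ i ℕ.* D) ≈ g (q ∸ i)
      sub-*-∸ i = trans (reflexive (≡.cong (sub D g) (≡.sym (ℕ.*-distribʳ-∸ D q i)))) (sub-* k g (q ∸ i))
    off : ∀ {m} → ¬ (D ∣ m) → (sub D f ⊛ sub D g) m ≈ 0#
    off {m} d∤m = trans (⊛-∑ (sub D f) (sub D g) m) (∑-zero (suc m) H≈0)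
      where
      H≈0 : ∀ j → j < suc m → H m j ≈ 0#
      H≈0 j j<1+m = cases (D ∣? j)
        where
        cases : Dec (D ∣ j) → H m j ≈ 0#
        cases (no d∤j) = trans (*-congʳ (sub-∤ D f d∤j)) (zeroˡ _)
        cases (yes d∣j) =
          trans (*-congˡ (sub-∤ D g (λ d∣m∸j → d∤m (∣m∸n∣n⇒∣m D (ℕ.≤-pred j<1+m) d∣m∸j d∣j)))) (zeroʳ _)


module ChainInversion {c ℓ : Level} (R : CommutativeRing c ℓ) where

  open import Data.List using ([]; _∷_; [_]; _∷ʳ_; map; length; concatMap)
  open import Data.List.Membership.Propositional using (_∈_)
  open import Data.List.Properties using (length-map)
  open import Data.List.Relation.Unary.All as All using (All; []; _∷_)
  open import Data.Nat using (ℕ; suc; _*_; _≤_; _<_; s≤s; z≤n)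
  open import Data.Nat.DivMod using (m*n/m*o≡n/o; n/1≡n)
  open import Data.Nat.Properties using (*-identityʳ)
  open import Data.Product using (_,_; proj₁)
  open import Relation.Binary.PropositionalEquality as ≡ using (_≡_)

  open PowerSeries R
  open SeriesAlgebra R

  chainProd-∷ʳ : ∀ S cs {d} n → chainProd S (cs ∷ʳ d ∷ʳ n) ≋ (chainProd S (cs ∷ʳ d) ⊛ sub d (S (n div d)))
  chainProd-∷ʳ S [] {d} n = ≋-trans (⊛-𝟙 _) (≋-sym (𝟙-⊛ _))
  chainProd-∷ʳ S (x ∷ []) {d} n = ≋-trans (⊛-cong ≋-refl (chainProd-∷ʳ S [] {d} n)) (≋-sym (⊛-assoc _ _ _))
  chainProd-∷ʳ S (x ∷ y ∷ cs) n = ≋-trans (⊛-cong ≋-refl (chainProd-∷ʳ S (y ∷ cs) n)) (≋-sym (⊛-assoc _ _ _))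

  lastOr1-map : ∀ (f : ℕ → ℕ) x cs → lastOr1 (map f (x ∷ cs)) ≡ f (lastOr1 (x ∷ cs))
  lastOr1-map f x [] = ≡.refl
  lastOr1-map f x (y ∷ cs) = lastOr1-map f y cs

  lastOr1-All : ∀ {P : ℕ → Set} x cs → All P (x ∷ cs) → P (lastOr1 (x ∷ cs))
  lastOr1-All x [] (px ∷ []) = px
  lastOr1-All x (y ∷ cs) (_ ∷ pcs) = lastOr1-All y cs pcs

  chainProd-scale : ∀ S k cs → All (1 ≤_) cs → chainProd S (map (suc k *_) cs) ≋ sub (suc k) (chainProd S cs)
  chainProd-scale S k [] _ = ≋-sym (sub-𝟙 k)
  chainProd-scale S k (x ∷ []) _ = ≋-sym (sub-𝟙 k)
  chainProd-scale S k (suc a ∷ y ∷ cs) (_ ∷ pos) = begin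
    (sub (D * suc a) (S ((D * y) div (D * suc a))) ⊛ chainProd S (map (D *_) (y ∷ cs)))
      ≡⟨ ≡.cong (λ q → sub (D * suc a) (S q) ⊛ chainProd S (map (D *_) (y ∷ cs))) (m*n/m*o≡n/o D y (suc a)) ⟩
    (sub (D * suc a) (S (y div suc a)) ⊛ chainProd S (map (D *_) (y ∷ cs)))
      ≈⟨ ⊛-cong (≋-sym (sub-sub k a _)) (chainProd-scale S k (y ∷ cs) pos) ⟩
    (sub D (sub (suc a) (S (y div suc a))) ⊛ sub D (chainProd S (y ∷ cs)))
      ≈⟨ sub-⊛ k _ _ ⟨
    sub D (chainProd S (suc a ∷ y ∷ cs))
      ∎
    where
    open ≋-Reasoning
    D = suc k

  chainProd-dilate : ∀ S {d} cs → 1 ≤ d → All (1 ≤_) cs →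
    chainProd S (dilate d (1 ∷ cs)) ≋ (S d ⊛ sub d (chainProd S (1 ∷ cs)))
  chainProd-dilate S {suc k} cs _ pos = ⊛-cong first-step (chainProd-scale S k (1 ∷ cs) (s≤s z≤n ∷ pos))
    where
    first-step : sub 1 (S ((suc k * 1) div 1)) ≋ S (suc k)
    first-step = ≋-trans (sub-1 _) (≋-reflexive (≡.cong S (≡.trans (n/1≡n _) (*-identityʳ (suc k)))))

  module _ (B C : ℕ → Series) where

    chainSumII : ℕ → Series
    chainSumII n = ΣS (map (termII B C) (chainsII n))

    termII-∷ʳ : ∀ cs {d} n → termII B C (cs ∷ʳ d ∷ʳ n) ≋ (termII B C (cs ∷ʳ d) ⊛ sub d (C (n div d)))
    termII-∷ʳ [] {d} n = ≋-trans (⊛-cong (≋-refl {B d}) (chainProd-∷ʳ C [] {d} n)) (≋-sym (⊛-assoc _ _ _))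
    termII-∷ʳ (x ∷ cs) n = ≋-trans (⊛-cong (≋-refl {B x}) (chainProd-∷ʳ C (x ∷ cs) n)) (≋-sym (⊛-assoc _ _ _))

    chainSumII-recursion : ∀ n → 1 ≤ n →
      chainSumII n ≋ (B n ⊕ ΣS (map (λ d → chainSumII d ⊛ sub d (C (n div d))) (properDivisors n)))
    chainSumII-recursion n 1≤n = begin
      ΣS (map t (chainsII n))
        ≈⟨ ΣS-↭ t (chainsII-↭ 1≤n) ⟩
      (t [ n ] ⊕ ΣS (map t (concatMap (chainsII-via n) (properDivisors n))))
        ≈⟨ ⊕-cong (⊛-𝟙 (B n)) (ΣS-concatMap t (chainsII-via n) (properDivisors n)) ⟩
      (B n ⊕ ΣS (map (λ d → ΣS (map t (chainsII-via n d))) (properDivisors n)))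
        ≈⟨ ⊕-cong ≋-refl (ΣS-cong (properDivisors n) (λ {d} _ → extend d)) ⟩
      (B n ⊕ ΣS (map (λ d → chainSumII d ⊛ sub d (C (n div d))) (properDivisors n)))
        ∎
      where
      open ≋-Reasoning
      t = termII B C
      extend : ∀ d → ΣS (map t (chainsII-via n d)) ≋ (chainSumII d ⊛ sub d (C (n div d)))
      extend d = begin
        ΣS (map t (map (_∷ʳ n) (chainsII d)))                 ≈⟨ ΣS-map t (_∷ʳ n) (chainsII d) ⟩
        ΣS (map (λ cs → t (cs ∷ʳ n)) (chainsII d))            ≈⟨ ΣS-cong (chainsII d) snoc ⟩
        ΣS (map (λ cs → t cs ⊛ sub d (C (n div d))) (chainsII d)) ≈⟨ ΣS-⊛ (sub d (C (n div d))) t (chainsII d) ⟨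
        (chainSumII d ⊛ sub d (C (n div d)))                  ∎
        where
        snoc : ∀ {cs} → cs ∈ chainsII d → t (cs ∷ʳ n) ≋ (t cs ⊛ sub d (C (n div d)))
        snoc cs∈ with ∈-chainsII⁻ {d} cs∈
        ... | chainII cs′ _ = termII-∷ʳ cs′ n

  inversionII : (A B C : ℕ → Series) →
    (∀ n → 1 ≤ n → A n ≋ (B n ⊕ ΣS (map (λ d → A d ⊛ sub d (C (n div d))) (properDivisors n)))) →
    ∀ n → 1 ≤ n → A n ≋ chainSumII B C n
  inversionII A B C A-rec = recursion-unique ≋-setoid Φ Φ-local A-rec (chainSumII-recursion B C)
    where
    Φ : ℕ → (ℕ → Series) → Series
    Φ n F = B n ⊕ ΣS (map (λ d → F d ⊛ sub d (C (n div d))) (properDivisors n))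
    Φ-local : ∀ n {F G} → 1 ≤ n → (∀ m → 1 ≤ m → m < n → F m ≋ G m) → Φ n F ≋ Φ n G
    Φ-local n 1≤n F≋G = ⊕-cong ≋-refl (ΣS-cong (properDivisors n) λ d∈ →
      let d⊏n = ∈-properDivisors⁻ d∈ in ⊛-cong (F≋G _ (∣⇒pos 1≤n (proj₁ d⊏n)) (⊏⇒< 1≤n d⊏n)) ≋-refl)

  module _ (A B : ℕ → Series) where

    chainSumI : ℕ → Series
    chainSumI n = ΣS (map (termI A B n) (chainsI n))

    termI-dilate : ∀ n {d} cs → 1 ≤ d → All (1 ≤_) cs →
      termI A B n (dilate d (1 ∷ cs)) ≋ (⊖ (B d ⊛ sub d (termI A B (n div d) (1 ∷ cs))))
    termI-dilate n {d@(suc k)} cs 1≤d pos = begin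
      termI A B n (dilate d (1 ∷ cs))
        ≡⟨ ≡.cong₂ (λ j M → signed j (sub M (A (n div M)) ⊛ chainProd B (dilate d (1 ∷ cs))))
                   (length-map (d *_) (1 ∷ cs)) (lastOr1-map (d *_) 1 cs) ⟩
      (⊖ signed j (sub (d * L) (A (n div (d * L))) ⊛ chainProd B (dilate d (1 ∷ cs))))
        ≈⟨ ⊖-cong (signed-cong j (⊛-cong (sub-div-* A n 1≤d 1≤L) (chainProd-dilate B cs 1≤d pos))) ⟩
      (⊖ signed j (sub d X ⊛ (B d ⊛ sub d P)))
        ≈⟨ ⊖-cong (signed-cong j (⊛-exchange (sub d X) (B d) (sub d P))) ⟩
      (⊖ signed j (B d ⊛ (sub d X ⊛ sub d P)))
        ≈⟨ ⊖-cong (signed-cong j (⊛-cong ≋-refl (sub-⊛ k X P))) ⟨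
      (⊖ signed j (B d ⊛ sub d (X ⊛ P)))
        ≈⟨ ⊖-cong (⊛-signed j (B d) _) ⟨
      (⊖ (B d ⊛ signed j (sub d (X ⊛ P))))
        ≈⟨ ⊖-cong (⊛-cong ≋-refl (sub-signed d j _)) ⟨
      (⊖ (B d ⊛ sub d (termI A B (n div d) (1 ∷ cs))))
        ∎
      where
      open ≋-Reasoning
      j = length cs
      L = lastOr1 (1 ∷ cs)
      1≤L = lastOr1-All 1 cs (s≤s z≤n ∷ pos)
      X = sub L (A ((n div d) div L))
      P = chainProd B (1 ∷ cs)

    chainSumI-recursion : ∀ n → 1 ≤ n →
      chainSumI n ≋ (A n ⊕ ΣS (map (λ d → ⊖ (B d ⊛ sub d (chainSumI (n div d)))) (nontrivialDivisors n)))
    chainSumI-recursion n 1≤n = begin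
      ΣS (map t (chainsI n))
        ≈⟨ ΣS-↭ t (chainsI-↭ 1≤n) ⟩
      (t [ 1 ] ⊕ ΣS (map t (concatMap (chainsI-via n) (nontrivialDivisors n))))
        ≈⟨ ⊕-cong t[1]≋A (ΣS-concatMap t (chainsI-via n) (nontrivialDivisors n)) ⟩
      (A n ⊕ ΣS (map (λ d → ΣS (map t (chainsI-via n d))) (nontrivialDivisors n)))
        ≈⟨ ⊕-cong ≋-refl (ΣS-cong (nontrivialDivisors n) dilated) ⟩
      (A n ⊕ ΣS (map (λ d → ⊖ (B d ⊛ sub d (chainSumI (n div d)))) (nontrivialDivisors n)))
        ∎
      where
      open ≋-Reasoning
      t = termI A B n
      t[1]≋A : t [ 1 ] ≋ A n
      t[1]≋A = ≋-trans (⊛-𝟙 _) (≋-trans (sub-1 _) (≋-reflexive (≡.cong A (n/1≡n n))))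
      dilated : ∀ {d} → d ∈ nontrivialDivisors n → ΣS (map t (chainsI-via n d)) ≋ (⊖ (B d ⊛ sub d (chainSumI (n div d))))
      dilated {d} d∈ = begin
        ΣS (map t (map (dilate d) (chainsI (n div d))))
          ≈⟨ ΣS-map t (dilate d) (chainsI (n div d)) ⟩
        ΣS (map (λ cs → t (dilate d cs)) (chainsI (n div d)))
          ≈⟨ ΣS-cong (chainsI (n div d)) one-chain ⟩
        ΣS (map (λ cs → ⊖ (B d ⊛ sub d (termI A B (n div d) cs))) (chainsI (n div d)))
          ≈⟨ ⊖-ΣS _ (chainsI (n div d)) ⟨
        (⊖ ΣS (map (λ cs → B d ⊛ sub d (termI A B (n div d) cs)) (chainsI (n div d))))
          ≈⟨ ⊖-cong (⊛-ΣS (B d) _ (chainsI (n div d))) ⟨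
        (⊖ (B d ⊛ ΣS (map (λ cs → sub d (termI A B (n div d) cs)) (chainsI (n div d)))))
          ≈⟨ ⊖-cong (⊛-cong ≋-refl (sub-ΣS d (termI A B (n div d)) (chainsI (n div d)))) ⟨
        (⊖ (B d ⊛ sub d (chainSumI (n div d))))
          ∎
        where
        d∣n = proj₁ (∈-nontrivialDivisors⁻ {n = n} d∈)
        one-chain : ∀ {cs} → cs ∈ chainsI (n div d) → t (dilate d cs) ≋ (⊖ (B d ⊛ sub d (termI A B (n div d) cs)))
        one-chain cs∈ with ∈-chainsI⁻ {n div d} cs∈
        ... | chainI {cs} _ cs∣ = termI-dilate n cs (∣⇒pos 1≤n d∣n) (All.map (∣⇒pos (div-pos 1≤n d∣n)) cs∣)

  inversionI : (A B C : ℕ → Series) → B 1 ≋ 𝟙 →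
    (∀ n → 1 ≤ n → A n ≋ sumDiv n (λ d → B d ⊛ sub d (C (n div d)))) →
    ∀ n → 1 ≤ n → C n ≋ chainSumI A B n
  inversionI A B C B₁≋𝟙 A≋ = recursion-unique ≋-setoid Φ Φ-local C-rec (chainSumI-recursion A B)
    where
    Φ : ℕ → (ℕ → Series) → Series
    Φ n F = A n ⊕ ΣS (map (λ d → ⊖ (B d ⊛ sub d (F (n div d)))) (nontrivialDivisors n))
    Φ-local : ∀ n {F G} → 1 ≤ n → (∀ m → 1 ≤ m → m < n → F m ≋ G m) → Φ n F ≋ Φ n G
    Φ-local n 1≤n F≋G = ⊕-cong ≋-refl (ΣS-cong (nontrivialDivisors n) λ {d} d∈ →
      let d∣n , d≢1 = ∈-nontrivialDivisors⁻ {n = n} d∈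
      in ⊖-cong (⊛-cong ≋-refl (sub-cong d (F≋G _ (div-pos 1≤n d∣n) (div-< 1≤n d∣n d≢1)))))
    C-rec : ∀ n → 1 ≤ n → C n ≋ Φ n C
    C-rec n 1≤n = ≋-trans (⊕-transpose (≋-trans (A≋ n 1≤n) split)) (⊕-cong ≋-refl (⊖-ΣS F (nontrivialDivisors n)))
      where
      F = λ d → B d ⊛ sub d (C (n div d))
      split : sumDiv n F ≋ (C n ⊕ ΣS (map F (nontrivialDivisors n)))
      split = begin
        ΣS (map F (divisors n))
          ≡⟨ ≡.cong (λ ds → ΣS (map F ds)) (divisors≡1∷nontrivialDivisors n 1≤n) ⟩
        (F 1 ⊕ ΣS (map F (nontrivialDivisors n)))
          ≈⟨ ⊕-cong F₁≋C ≋-refl ⟩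
        (C n ⊕ ΣS (map F (nontrivialDivisors n)))
          ∎
        where
        open ≋-Reasoning
        F₁≋C : F 1 ≋ C n
        F₁≋C = ≋-trans (⊛-cong B₁≋𝟙 (sub-1 _)) (≋-trans (𝟙-⊛ _) (≋-reflexive (≡.cong C (n/1≡n n))))

lemma4p4 : {c ℓ : Level} (R : CommutativeRing c ℓ) → let open PowerSeries R in
  (A B C : ℕ → Series) →
  ((B 1 ≋ 𝟙) →
     (∀ n → 1 ≤ n → A n ≋ sumDiv n (λ d → B d ⊛ sub d (C (n div d)))) →
     ∀ n → 1 ≤ n → C n ≋ ΣS (map (termI A B n) (chainsI n)))
  ×
  ((∀ n → 1 ≤ n → A n ≋ (B n ⊕ ΣS (map (λ d → A d ⊛ sub d (C (n div d))) (properDivisors n)))) →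
     ∀ n → 1 ≤ n → A n ≋ ΣS (map (termII B C) (chainsII n)))
lemma4p4 R A B C = ChainInversion.inversionI R A B C , ChainInversion.inversionII R A B C
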